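{- Let $T$ be a perfect binary tree, and run majority dynamics from some $\xi_0\in\{ -1,1\}^{V(T)}$. Let $t\in\mathbb{Z}_{\ge0}$, $\xi\in\{ -1,1\}$, $d\in2\mathbb{Z}_{>0}$, and let $P=v_0v_1\ldots v_d$ be a path in $T$ such that \begin{itemize} \item $V(T_{v_0})\cap V(T_{v_d})=\varnothing$; \item $\xi_t(v_i)=\xi$ for every even $i\in\{0,\ldots,d\}$; \item $v_0$ and $v_d$ are weakly $t$-stable. \end{itemize} Then $v_i$ is $t$-stable for every even $i\in\{0,\ldots,d\}$.
   Context: A perfect binary tree (rooted at $R$) has a root with $3$ children, every other non-leaf vertex has $2$ children, and all leaves are at the same distance from $R$. $T_v$ is the subtree consisting of $v$ and its descendants. Majority dynamics: for $t\ge1$, $\xi_t(i)=\mathrm{sign}\sum_{j\in N(i)}\xi_{t-1}(j)$. A vertex $u$ is $t$-stable if $\xi_s(u)=\xi_{s+2}(u)$ for all $s\ge t$ with the same parity as $t$. A non-root vertex $v$ is weakly $t$-stable (w.r.t. $\xi_t$) if there exists $\tilde\xi_0\in\{ -1,1\}^{V(T)}$ with $\tilde\xi_0|_{V(T_v)}=\xi_t|_{V(T_v)}$ such that $v$ is $0$-stable for the dynamics started at $\tilde\xi_0$. -}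

module Defs where

open import Data.Nat using (ℕ; zero; suc; _+_; _*_; _≤_; _<_; _<ᵇ_)
open import Data.Nat.DivMod using (_%_)
open import Data.Integer using (ℤ; +_; -[1+_])
import Data.Integer as ℤ
open import Data.Bool using (Bool; true; false; if_then_else_)
open import Data.Fin using (Fin; toℕ)
open import Data.List using (List; []; _∷_; _++_; map; length)
open import Data.List.Base using (allFin)
open import Data.Sum using (_⊎_)
open import Data.Product using (Σ; ∃; ∃-syntax; _×_; _,_)
open import Relation.Binary.PropositionalEquality using (_≡_; _≢_)
open import Relation.Binary.Construct.Closure.ReflexiveTransitive using (Star)

-- The perfect tree of height h (root has 3 children, every other
-- non-leaf vertex has 2 children, all leaves at distance h from R).
-- A vertex is addressed by its path from the root R: either R itself,
-- or a choice among the 3 children of R followed by a list of binary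
-- choices (stored most-recent-first).  The vertices of T (height h)
-- are the addresses of depth ≤ h.

data Addr : Set where
  root   : Addr
  branch : Fin 3 → List Bool → Addr

depth : Addr → ℕ
depth root          = 0
depth (branch _ bs) = suc (length bs)

InT : ℕ → Addr → Set
InT h a = depth a ≤ h

data Child : Addr → Addr → Set where
  rootChild   : ∀ i → Child root (branch i [])
  branchChild : ∀ i b bs → Child (branch i bs) (branch i (b ∷ bs))

Adj : ℕ → Addr → Addr → Set
Adj h u v = InT h u × InT h v × (Child u v ⊎ Child v u)

-- Desc v u : u ∈ V(T_v), i.e. u is v or a descendant of v
Desc : Addr → Addr → Set
Desc = Star Child

data Spin : Set where
  plus minus : Spin

toℤ : Spin → ℤ
toℤ plus  = + 1
toℤ minus = ℤ.- (+ 1)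

-- sign; the value at 0 is irrelevant for h ≥ 1 (all degrees are odd)
sgn : ℤ → Spin
sgn (+ _)      = plus
sgn -[1+ _ ]   = minus

parents : Addr → List Addr
parents root                  = []
parents (branch i [])         = root ∷ []
parents (branch i (_ ∷ bs))   = branch i bs ∷ []

children : Addr → List Addr
children root          = map (λ i → branch i []) (allFin 3)
children (branch i bs) = branch i (true ∷ bs) ∷ branch i (false ∷ bs) ∷ []

nbrs : ℕ → Addr → List Addr
nbrs h a = parents a ++ (if depth a <ᵇ h then children a else [])

sumℤ : List ℤ → ℤ
sumℤ []       = + 0
sumℤ (x ∷ xs) = x ℤ.+ sumℤ xs

Config : Set
Config = Addr → Spin

step : ℕ → Config → Config
step h σ a = sgn (sumℤ (map (λ b → toℤ (σ b)) (nbrs h a)))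

dyn : ℕ → Config → ℕ → Config
dyn h ξ₀ zero    = ξ₀
dyn h ξ₀ (suc t) = step h (dyn h ξ₀ t)

Stable : ℕ → Config → ℕ → Addr → Set
Stable h ξ₀ t u = ∀ s → t ≤ s → s % 2 ≡ t % 2 →
  dyn h ξ₀ s u ≡ dyn h ξ₀ (s + 2) u

WeaklyStable : ℕ → Config → ℕ → Addr → Set
WeaklyStable h ξ₀ t v =
  v ≢ root ×
  ∃[ ξ̃₀ ] ((∀ u → InT h u → Desc v u → ξ̃₀ u ≡ dyn h ξ₀ t u)
           × Stable h ξ̃₀ 0 v)

IsPath : ℕ → (d : ℕ) → (Fin (suc d) → Addr) → Set
IsPath h d v =
  (∀ i → InT h (v i)) ×
  (∀ (i : Fin d) → Adj h (v (Data.Fin.inject₁ i)) (v (Data.Fin.suc i))) ×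
  (∀ i j → v i ≡ v j → i ≡ j)

{-# OPTIONS --safe #-}
-- Write σₛ for ξ_{t+s}.  On the subtree T_e of an end e, compare σ with the
-- dynamics τ started from the configuration witnessing weak stability of e:
-- on the vertices of T_e whose depth has the parity of depth e + s, σₛ shows ξ
-- wherever τₛ does, as long as the parent of e shows ξ under σ at odd times.
-- Since τ fixes e at even times, σₛ(e) = ξ for even s.  Disjointness of the end
-- subtrees makes v₁ and v_{d-1} the parents of v₀ and v_d.  An inner vertex v_i of
-- the path has three neighbours, two of which are v_{i-1} and v_{i+1}; if both
-- show ξ, so does v_i one step later.  A joint induction on s then gives
-- σₛ(v_i) = ξ whenever i + s is even.
module Submission where

open import Defs
open import Data.Nat using (ℕ; zero; suc; _+_; _∸_; _<_; _≤_; z≤n; s≤s; _<ᵇ_; parity)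
open import Data.Nat.Properties
  using (≤-refl; <⇒≤; n≤1+n; +-suc; +-comm; +-assoc; +-identityʳ; m+[n∸m]≡n; m∸n≤m;
         ∸-cancelˡ-≡; +-∸-assoc; n∸n≡0; 0≢1+n; m≢1+n+m; m≤n⇒m<n∨m≡n; <ᵇ⇒<; <⇒<ᵇ)
open import Data.Nat.DivMod using (_%_)
open import Data.Parity using (0ℙ)
import Data.Parity as ℙ
import Data.Parity.Properties as ℙ
open import Data.Integer using (+_; -[1+_])
import Data.Integer as ℤ
import Data.Integer.Properties as ℤ
open import Data.Bool using (true; false; if_then_else_; T)
open import Data.Unit using (tt)
open import Data.Fin using (Fin; toℕ; fromℕ; fromℕ<; inject₁; zero; suc)
open import Data.Fin.Properties using (toℕ≤pred[n]; toℕ-fromℕ; toℕ-fromℕ<)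
open import Data.List using (List; []; _∷_; map; length)
open import Data.List.Relation.Unary.Any using (here; there)
open import Data.List.Membership.Propositional using (_∈_)
open import Data.List.Membership.Propositional.Properties using (∈-++⁺ˡ; ∈-++⁺ʳ; ∈-++⁻)
open import Data.Product using (_×_; _,_; ∃-syntax; proj₁; proj₂)
open import Data.Sum using (_⊎_; inj₁; inj₂; swap)
open import Data.Empty using (⊥-elim)
open import Function using (_∘_)
open import Relation.Nullary using (¬_)
open import Relation.Binary.PropositionalEquality
  using (_≡_; _≢_; refl; sym; trans; cong; subst; module ≡-Reasoning)
open import Relation.Binary.Construct.Closure.ReflexiveTransitive using (ε; _◅_; _◅◅_)

parity-%2 : ∀ n → parity (n % 2) ≡ parity n
parity-%2 zero          = refl
parity-%2 (suc zero)    = refl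
parity-%2 (suc (suc n)) = parity-%2 n

≡-mod-2⇒parity≡ : ∀ m n → m % 2 ≡ n % 2 → parity m ≡ parity n
≡-mod-2⇒parity≡ m n eq = trans (sym (parity-%2 m)) (trans (cong parity eq) (parity-%2 n))

parity≡0ℙ⇒%2≡0 : ∀ n → parity n ≡ 0ℙ → n % 2 ≡ 0
parity≡0ℙ⇒%2≡0 zero          _    = refl
parity≡0ℙ⇒%2≡0 (suc (suc n)) even = parity≡0ℙ⇒%2≡0 n even

parity-+-evenˡ : ∀ m n → parity m ≡ 0ℙ → parity (m + n) ≡ parity n
parity-+-evenˡ m n even = trans (ℙ.+-homo-+ m n) (cong (ℙ._+ parity n) even)

parity-+-evenʳ : ∀ m n → parity n ≡ 0ℙ → parity (m + n) ≡ parity m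
parity-+-evenʳ m n even =
  trans (ℙ.+-homo-+ m n) (trans (cong (parity m ℙ.+_) even) (ℙ.+-identityʳ (parity m)))

parity-+-cancelˡ : ∀ m n → parity (m + n) ≡ parity m → parity n ≡ 0ℙ
parity-+-cancelˡ m n eq = ℙ.+-cancelˡ-≡ (parity m) (parity n) 0ℙ
  (trans (sym (ℙ.+-homo-+ m n)) (trans eq (sym (ℙ.+-identityʳ (parity m)))))

parity-suc-+-suc : ∀ m n → parity (suc m + suc n) ≡ parity (m + n)
parity-suc-+-suc m n = cong (parity ∘ suc) (+-suc m n)

dyn-+ : ∀ h σ t s → dyn h σ (t + s) ≡ dyn h (dyn h σ t) s
dyn-+ h σ t zero    = cong (dyn h σ) (+-identityʳ t)
dyn-+ h σ t (suc s) = trans (cong (dyn h σ) (+-suc t s)) (cong (step h) (dyn-+ h σ t s))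

stable⇒fixed-at-even-times : ∀ {h τ u} → Stable h τ 0 u → ∀ m → parity m ≡ 0ℙ → dyn h τ m u ≡ τ u
stable⇒fixed-at-even-times         stable zero          _    = refl
stable⇒fixed-at-even-times {h} {τ} {u} stable (suc (suc m)) even = begin
  dyn h τ (2 + m) u  ≡⟨ cong (λ k → dyn h τ k u) (+-comm 2 m) ⟩
  dyn h τ (m + 2) u  ≡⟨ sym (stable m z≤n (parity≡0ℙ⇒%2≡0 m even)) ⟩
  dyn h τ m u        ≡⟨ stable⇒fixed-at-even-times stable m even ⟩
  τ u                ∎
  where open ≡-Reasoning

fixed-at-even-times⇒stable : ∀ {h ξ₀ t u x} →
  (∀ m → parity m ≡ 0ℙ → dyn h (dyn h ξ₀ t) m u ≡ x) → Stable h ξ₀ t u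
fixed-at-even-times⇒stable {h} {ξ₀} {t} {u} {x} fixed s t≤s s≡t =
  trans (at m m-even s≡t+m) (sym (at (2 + m) m-even s+2≡t+2+m))
  where
  m : ℕ
  m = s ∸ t
  s≡t+m : s ≡ t + m
  s≡t+m = sym (m+[n∸m]≡n t≤s)
  m-even : parity m ≡ 0ℙ
  m-even = parity-+-cancelˡ t m (trans (cong parity (sym s≡t+m)) (≡-mod-2⇒parity≡ s t s≡t))
  s+2≡t+2+m : s + 2 ≡ t + (2 + m)
  s+2≡t+2+m = trans (cong (_+ 2) s≡t+m) (trans (+-assoc t m 2) (cong (λ k → t + k) (+-comm m 2)))
  at : ∀ k → parity k ≡ 0ℙ → ∀ {r} → r ≡ t + k → dyn h ξ₀ r u ≡ x
  at k even refl = trans (cong (λ σ → σ u) (dyn-+ h ξ₀ t k)) (fixed k even)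

majority : Config → List Addr → Spin
majority σ L = sgn (sumℤ (map (λ b → toℤ (σ b)) L))

_≤ₛ_ : Spin → Spin → Set
x ≤ₛ y = toℤ x ℤ.≤ toℤ y

minus-≤ₛ : ∀ x → minus ≤ₛ x
minus-≤ₛ plus  = ℤ.-≤+
minus-≤ₛ minus = ℤ.≤-refl

sgn-mono : ∀ {a b} → a ℤ.≤ b → sgn a ≤ₛ sgn b
sgn-mono {+ _}      {+ _}      _ = ℤ.≤-refl
sgn-mono { -[1+ _ ]} {b}       _ = minus-≤ₛ (sgn b)
sgn-mono {+ _}      { -[1+ _ ]} ()

majority-mono : ∀ {σ τ} L → (∀ {b} → b ∈ L → σ b ≤ₛ τ b) → majority σ L ≤ₛ majority τ L
majority-mono {σ} {τ} L le = sgn-mono (sum-mono L le)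
  where
  sum-mono : ∀ L → (∀ {b} → b ∈ L → σ b ≤ₛ τ b) →
    sumℤ (map (λ b → toℤ (σ b)) L) ℤ.≤ sumℤ (map (λ b → toℤ (τ b)) L)
  sum-mono []      _  = ℤ.≤-refl
  sum-mono (b ∷ L) le = ℤ.+-mono-≤ (le (here refl)) (sum-mono L (le ∘ there))

_⊒⟨_⟩_ : Spin → Spin → Spin → Set
x ⊒⟨ ξ ⟩ y = y ≡ ξ → x ≡ ξ

⊒⟨plus⟩⇒≤ₛ : ∀ {x y} → x ⊒⟨ plus ⟩ y → y ≤ₛ x
⊒⟨plus⟩⇒≤ₛ {x} {minus} _   = minus-≤ₛ x
⊒⟨plus⟩⇒≤ₛ {x} {plus}  dom rewrite dom refl = ℤ.≤-refl

≤ₛ⇒⊒⟨plus⟩ : ∀ {x y} → y ≤ₛ x → x ⊒⟨ plus ⟩ y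
≤ₛ⇒⊒⟨plus⟩ {plus}  _ _ = refl
≤ₛ⇒⊒⟨plus⟩ {minus} () refl

⊒⟨minus⟩⇒≤ₛ : ∀ {x y} → x ⊒⟨ minus ⟩ y → x ≤ₛ y
⊒⟨minus⟩⇒≤ₛ {minus} {y}     _   = minus-≤ₛ y
⊒⟨minus⟩⇒≤ₛ {plus}  {plus}  _   = ℤ.≤-refl
⊒⟨minus⟩⇒≤ₛ {plus}  {minus} dom with dom refl
... | ()

≤ₛ⇒⊒⟨minus⟩ : ∀ {x y} → x ≤ₛ y → x ⊒⟨ minus ⟩ y
≤ₛ⇒⊒⟨minus⟩ {minus} _ _ = refl
≤ₛ⇒⊒⟨minus⟩ {plus} {minus} () refl

majority-dominance : ∀ ξ {σ τ} L → (∀ {b} → b ∈ L → σ b ⊒⟨ ξ ⟩ τ b) →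
  majority σ L ⊒⟨ ξ ⟩ majority τ L
majority-dominance plus  {σ} {τ} L dom =
  ≤ₛ⇒⊒⟨plus⟩ (majority-mono {τ} {σ} L (λ b∈L → ⊒⟨plus⟩⇒≤ₛ (dom b∈L)))
majority-dominance minus {σ} {τ} L dom =
  ≤ₛ⇒⊒⟨minus⟩ (majority-mono {σ} {τ} L (λ b∈L → ⊒⟨minus⟩⇒≤ₛ (dom b∈L)))

majority₃ : Spin → Spin → Spin → Spin
majority₃ x y z = sgn (toℤ x ℤ.+ (toℤ y ℤ.+ (toℤ z ℤ.+ + 0)))

majority₃-two : ∀ ξ r → majority₃ ξ ξ r ≡ ξ × majority₃ ξ r ξ ≡ ξ × majority₃ r ξ ξ ≡ ξ
majority₃-two plus  plus  = refl , refl , refl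
majority₃-two plus  minus = refl , refl , refl
majority₃-two minus plus  = refl , refl , refl
majority₃-two minus minus = refl , refl , refl

majority-two-of-three : ∀ {σ ξ a b c x y} → x ≢ y →
  x ∈ a ∷ b ∷ c ∷ [] → y ∈ a ∷ b ∷ c ∷ [] → σ x ≡ ξ → σ y ≡ ξ → majority σ (a ∷ b ∷ c ∷ []) ≡ ξ
majority-two-of-three x≢y (here refl)                 (here refl)                 _  _  = ⊥-elim (x≢y refl)
majority-two-of-three x≢y (there (here refl))         (there (here refl))         _  _  = ⊥-elim (x≢y refl)
majority-two-of-three x≢y (there (there (here refl))) (there (there (here refl))) _  _  = ⊥-elim (x≢y refl)
majority-two-of-three _   (there (there (there ())))  _
majority-two-of-three _   _                           (there (there (there ())))
majority-two-of-three {σ} {ξ} {c = c} _ (here refl) (there (here refl)) σx σy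
  rewrite σx | σy = proj₁ (majority₃-two ξ (σ c))
majority-two-of-three {σ} {ξ} {c = c} _ (there (here refl)) (here refl) σx σy
  rewrite σx | σy = proj₁ (majority₃-two ξ (σ c))
majority-two-of-three {σ} {ξ} {b = b} _ (here refl) (there (there (here refl))) σx σy
  rewrite σx | σy = proj₁ (proj₂ (majority₃-two ξ (σ b)))
majority-two-of-three {σ} {ξ} {b = b} _ (there (there (here refl))) (here refl) σx σy
  rewrite σx | σy = proj₁ (proj₂ (majority₃-two ξ (σ b)))
majority-two-of-three {σ} {ξ} {a} _ (there (here refl)) (there (there (here refl))) σx σy
  rewrite σx | σy = proj₂ (proj₂ (majority₃-two ξ (σ a)))
majority-two-of-three {σ} {ξ} {a} _ (there (there (here refl))) (there (here refl)) σx σy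
  rewrite σx | σy = proj₂ (proj₂ (majority₃-two ξ (σ a)))

child-depth : ∀ {p c} → Child p c → depth c ≡ suc (depth p)
child-depth (rootChild _)         = refl
child-depth (branchChild _ _ _)   = refl

parent-unique : ∀ {p q u} → Child p u → Child q u → p ≡ q
parent-unique (rootChild _)       (rootChild _)       = refl
parent-unique (branchChild _ _ _) (branchChild _ _ _) = refl

Desc-parent : ∀ {a u p} → Desc a u → Child p u → a ≡ u ⊎ Desc a p
Desc-parent ε                  _   = inj₁ refl
Desc-parent (a→x ◅ x→u) p→u with Desc-parent x→u p→u
... | inj₂ x→p = inj₂ (a→x ◅ x→p)
... | inj₁ refl = inj₂ (subst (Desc _) (parent-unique a→x p→u) ε)

parent∈T : ∀ {h p c} → Child p c → InT h c → InT h p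
parent∈T (rootChild _)       _   = z≤n
parent∈T (branchChild _ _ _) c∈T = <⇒≤ c∈T

Adj-sym : ∀ {h u v} → Adj h u v → Adj h v u
Adj-sym (u∈T , v∈T , u~v) = v∈T , u∈T , swap u~v

∈children⇒Child : ∀ {u b} → b ∈ children u → Child u b
∈children⇒Child {root}       (here refl)                 = rootChild _
∈children⇒Child {root}       (there (here refl))         = rootChild _
∈children⇒Child {root}       (there (there (here refl))) = rootChild _
∈children⇒Child {branch i bs} (here refl)                = branchChild i true bs
∈children⇒Child {branch i bs} (there (here refl))        = branchChild i false bs

Child⇒∈children : ∀ {u b} → Child u b → b ∈ children u
Child⇒∈children (rootChild zero)             = here refl
Child⇒∈children (rootChild (suc zero))       = there (here refl)
Child⇒∈children (rootChild (suc (suc zero))) = there (there (here refl))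
Child⇒∈children (branchChild _ true _)       = here refl
Child⇒∈children (branchChild _ false _)      = there (here refl)

∈parents⇒Child : ∀ {u b} → b ∈ parents u → Child b u
∈parents⇒Child {branch i []}      (here refl) = rootChild i
∈parents⇒Child {branch i (x ∷ bs)} (here refl) = branchChild i x bs

Child⇒∈parents : ∀ {u b} → Child b u → b ∈ parents u
Child⇒∈parents (rootChild _)       = here refl
Child⇒∈parents (branchChild _ _ _) = here refl

∈-if-then-[] : ∀ {A : Set} {c} {xs : List A} {x} → x ∈ (if c then xs else []) → T c × x ∈ xs
∈-if-then-[] {c = true} x∈xs = tt , x∈xs

if-then-[]-∈ : ∀ {A : Set} {c} {xs : List A} {x} → T c → x ∈ xs → x ∈ (if c then xs else [])
if-then-[]-∈ {c = true} _ x∈xs = x∈xs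

∈nbrs⇒Adj : ∀ {h u b} → InT h u → b ∈ nbrs h u → Adj h u b
∈nbrs⇒Adj {h} {u} u∈T b∈N with ∈-++⁻ (parents u) b∈N
... | inj₁ b∈P = let b→u = ∈parents⇒Child b∈P in u∈T , parent∈T b→u u∈T , inj₂ b→u
... | inj₂ b∈C with ∈-if-then-[] b∈C
...   | u<h , b∈C′ = let u→b = ∈children⇒Child b∈C′ in
  u∈T , subst (_≤ h) (sym (child-depth u→b)) (<ᵇ⇒< (depth u) h u<h) , inj₁ u→b

Adj⇒∈nbrs : ∀ {h u b} → Adj h u b → b ∈ nbrs h u
Adj⇒∈nbrs         (_ , _   , inj₂ b→u) = ∈-++⁺ˡ (Child⇒∈parents b→u)
Adj⇒∈nbrs {h} {u} (_ , b∈T , inj₁ u→b) = ∈-++⁺ʳ (parents u)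
  (if-then-[]-∈ (<⇒<ᵇ (subst (_≤ h) (child-depth u→b) b∈T)) (Child⇒∈children u→b))

nbrs-subsingleton-or-triple : ∀ h u →
  (∀ {x y} → x ∈ nbrs h u → y ∈ nbrs h u → x ≡ y) ⊎ ∃[ a ] ∃[ b ] ∃[ c ] nbrs h u ≡ a ∷ b ∷ c ∷ []
nbrs-subsingleton-or-triple zero    root = inj₁ λ ()
nbrs-subsingleton-or-triple (suc h) root = inj₂ (_ , _ , _ , refl)
nbrs-subsingleton-or-triple h (branch i []) with 1 <ᵇ h
... | true  = inj₂ (_ , _ , _ , refl)
... | false = inj₁ λ { (here refl) (here refl) → refl }
nbrs-subsingleton-or-triple h (branch i (_ ∷ bs)) with suc (suc (length bs)) <ᵇ h
... | true  = inj₂ (_ , _ , _ , refl)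
... | false = inj₁ λ { (here refl) (here refl) → refl }

step-two-neighbours : ∀ {h σ ξ u x y} → x ≢ y → x ∈ nbrs h u → y ∈ nbrs h u →
  σ x ≡ ξ → σ y ≡ ξ → step h σ u ≡ ξ
step-two-neighbours {h} {σ} {ξ} {u} x≢y x∈N y∈N σx σy with nbrs-subsingleton-or-triple h u
... | inj₁ subsingleton = ⊥-elim (x≢y (subsingleton x∈N y∈N))
... | inj₂ (_ , _ , _ , N≡abc) = subst (λ L → majority σ L ≡ ξ) (sym N≡abc)
  (majority-two-of-three x≢y (subst (_ ∈_) N≡abc x∈N) (subst (_ ∈_) N≡abc y∈N) σx σy)

neighbour-phase : ∀ {u b} s → Child u b ⊎ Child b u → parity (depth b + s) ≡ parity (depth u + suc s)
neighbour-phase {u} {b} s (inj₁ u→b) rewrite child-depth u→b = cong parity (sym (+-suc (depth u) s))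
neighbour-phase {u} {b} s (inj₂ b→u) rewrite child-depth b→u = sym (parity-suc-+-suc (depth b) s)

-- Only vertices in phase with e are compared, so that e consults its parent only at
-- odd times s, when the path forces the parent to show ξ.
Dominates : ℕ → Spin → Config → Config → Addr → ℕ → Set
Dominates h ξ σ τ e s = ∀ u → InT h u → Desc e u → parity (depth u + s) ≡ parity (depth e) →
  dyn h σ s u ⊒⟨ ξ ⟩ dyn h τ s u

dominates-at-neighbour : ∀ {h ξ σ τ e p s u b} → Child p e → Dominates h ξ σ τ e s →
  (parity (suc s) ≡ 0ℙ → dyn h σ s p ≡ ξ) →
  Desc e u → parity (depth u + suc s) ≡ parity (depth e) → Adj h u b →
  dyn h σ s b ⊒⟨ ξ ⟩ dyn h τ s b
dominates-at-neighbour {s = s} {u} {b} _ dom _ e→u in-phase (_ , b∈T , inj₁ u→b) =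
  dom b b∈T (e→u ◅◅ u→b ◅ ε) (trans (neighbour-phase s (inj₁ u→b)) in-phase)
dominates-at-neighbour {s = s} {u} {b} p→e dom p-ξ e→u in-phase (_ , b∈T , inj₂ b→u)
  with Desc-parent e→u b→u
... | inj₂ e→b = dom b b∈T e→b (trans (neighbour-phase s (inj₂ b→u)) in-phase)
... | inj₁ refl with parent-unique b→u p→e
...   | refl = λ _ → p-ξ (parity-+-cancelˡ (depth u) (suc s) in-phase)

dominates-step : ∀ {h ξ σ τ e p s} → Child p e → Dominates h ξ σ τ e s →
  (parity (suc s) ≡ 0ℙ → dyn h σ s p ≡ ξ) → Dominates h ξ σ τ e (suc s)
dominates-step {h} {ξ} p→e dom p-ξ u u∈T e→u in-phase = majority-dominance ξ (nbrs h u)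
  (λ b∈N → dominates-at-neighbour p→e dom p-ξ e→u in-phase (∈nbrs⇒Adj u∈T b∈N))

module WeakStability (h : ℕ) (ξ₀ : Config) (t : ℕ) (ξ : Spin) where

  comparison : ∀ {e} → WeaklyStable h ξ₀ t e → Config
  comparison (_ , τ , _) = τ

  dominates-initially : ∀ {e} (ws : WeaklyStable h ξ₀ t e) →
    Dominates h ξ (dyn h ξ₀ t) (comparison ws) e 0
  dominates-initially (_ , _ , agrees , _) u u∈T e→u _ τu≡ξ = trans (sym (agrees u u∈T e→u)) τu≡ξ

  dominated-end : ∀ {e s} (ws : WeaklyStable h ξ₀ t e) → InT h e → dyn h ξ₀ t e ≡ ξ →
    Dominates h ξ (dyn h ξ₀ t) (comparison ws) e s → parity s ≡ 0ℙ → dyn h (dyn h ξ₀ t) s e ≡ ξ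
  dominated-end {e} {s} (_ , τ , agrees , stable) e∈T σe≡ξ dom even =
    dom e e∈T ε (parity-+-evenʳ (depth e) s even)
      (trans (stable⇒fixed-at-even-times stable s even) (trans (agrees e e∈T ε) σe≡ξ))

record IsPathℕ (h d : ℕ) (w : ℕ → Addr) : Set where
  field
    inT       : ∀ {k} → k ≤ d → InT h (w k)
    adjacent  : ∀ {k} → k < d → Adj h (w k) (w (suc k))
    injective : ∀ {j k} → j ≤ d → k ≤ d → w j ≡ w k → j ≡ k

reverse-adjacent : ∀ {h d} {w : ℕ → Addr} → (∀ {k} → k < d → Adj h (w k) (w (suc k))) →
  ∀ {k} → k < d → Adj h (w (d ∸ k)) (w (d ∸ suc k))
reverse-adjacent {h} {suc d} {w} adjacent {k} (s≤s k≤d) =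
  subst (λ i → Adj h (w i) (w (d ∸ k))) (sym (+-∸-assoc 1 k≤d)) (Adj-sym (adjacent (s≤s (m∸n≤m d k))))

reverse-path : ∀ {h d w} → IsPathℕ h d w → IsPathℕ h d (λ k → w (d ∸ k))
reverse-path {d = d} p = record
  { inT       = λ {k} _ → inT (m∸n≤m d k)
  ; adjacent  = reverse-adjacent adjacent
  ; injective = λ {j} {k} j≤d k≤d eq → ∸-cancelˡ-≡ j≤d k≤d (injective (m∸n≤m d j) (m∸n≤m d k) eq)
  }
  where open IsPathℕ p

stays-below : ∀ {h d w} → IsPathℕ h d w → Child (w 0) (w 1) → ∀ {k} → k ≤ d → Desc (w 0) (w k)
stays-below p down {zero}          _ = ε
stays-below p down {suc zero}      _ = down ◅ ε
stays-below p down {suc (suc k)} k+2≤d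
  with stays-below p down (<⇒≤ k+2≤d) | IsPathℕ.adjacent p k+2≤d
... | below | _ , _ , inj₁ step-down = below ◅◅ step-down ◅ ε
... | below | _ , _ , inj₂ step-up with Desc-parent below step-up
...   | inj₂ below′ = below′
...   | inj₁ w₀≡w₁₊ₖ = ⊥-elim (0≢1+n (IsPathℕ.injective p z≤n (<⇒≤ k+2≤d) w₀≡w₁₊ₖ))

first-step-up : ∀ {h d w} → IsPathℕ h d w → 0 < d → ¬ Desc (w 0) (w d) → Child (w 1) (w 0)
first-step-up p 0<d w₀↛w_d with IsPathℕ.adjacent p 0<d
... | _ , _ , inj₂ up   = up
... | _ , _ , inj₁ down = ⊥-elim (w₀↛w_d (stays-below p down ≤-refl))

last-step-up : ∀ {h d w} → IsPathℕ h (suc d) w → ¬ Desc (w (suc d)) (w 0) → Child (w d) (w (suc d))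
last-step-up {d = d} {w} p w_d↛w₀ = first-step-up (reverse-path p) (s≤s z≤n)
  (λ below → w_d↛w₀ (subst (λ k → Desc (w (suc d)) (w k)) (n∸n≡0 d) below))

clamp : ∀ d → ℕ → Fin (suc d)
clamp zero    _       = zero
clamp (suc d) zero    = zero
clamp (suc d) (suc k) = suc (clamp d k)

toℕ-clamp : ∀ {d k} → k ≤ d → toℕ (clamp d k) ≡ k
toℕ-clamp {zero}  z≤n       = refl
toℕ-clamp {suc d} {zero} _  = refl
toℕ-clamp {suc d} (s≤s k≤d) = cong suc (toℕ-clamp k≤d)

clamp-toℕ : ∀ {d} (j : Fin (suc d)) → clamp d (toℕ j) ≡ j
clamp-toℕ {zero}  zero    = refl
clamp-toℕ {suc d} zero    = refl
clamp-toℕ {suc d} (suc j) = cong suc (clamp-toℕ j)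

clamp-inject₁ : ∀ {d} (j : Fin d) → clamp d (toℕ j) ≡ inject₁ j
clamp-inject₁ {suc d} zero    = refl
clamp-inject₁ {suc d} (suc j) = cong suc (clamp-inject₁ j)

clamp-suc : ∀ {d} (j : Fin d) → clamp d (suc (toℕ j)) ≡ suc j
clamp-suc {suc d} j = cong suc (clamp-toℕ j)

IsPath⇒IsPathℕ : ∀ {h d v} → IsPath h d v → IsPathℕ h d (v ∘ clamp d)
IsPath⇒IsPathℕ {h} {d} {v} (v∈T , v-adjacent , v-injective) = record
  { inT       = λ {k} _ → v∈T (clamp d k)
  ; adjacent  = λ k<d → subst (λ k → Adj h (v (clamp d k)) (v (clamp d (suc k))))
                              (toℕ-fromℕ< k<d) (adjacent-at (fromℕ< k<d))
  ; injective = λ j≤d k≤d eq →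
      trans (sym (toℕ-clamp j≤d)) (trans (cong toℕ (v-injective _ _ eq)) (toℕ-clamp k≤d))
  }
  where
  adjacent-at : ∀ (j : Fin d) → Adj h (v (clamp d (toℕ j))) (v (clamp d (suc (toℕ j))))
  adjacent-at j rewrite clamp-inject₁ j | clamp-suc j = v-adjacent j

module EvenVertices
  {h : ℕ} {ξ₀ : Config} {t : ℕ} {ξ : Spin} {d′ : ℕ} {w : ℕ → Addr}
  (path : IsPathℕ h (suc d′) w)
  (d-even : parity (suc d′) ≡ 0ℙ)
  (disjoint : ∀ u → InT h u → ¬ (Desc (w 0) u × Desc (w (suc d′)) u))
  (ξ-at-even : ∀ {i} → i ≤ suc d′ → parity i ≡ 0ℙ → dyn h ξ₀ t (w i) ≡ ξ)
  (first : WeaklyStable h ξ₀ t (w 0))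
  (last : WeaklyStable h ξ₀ t (w (suc d′)))
  where

  open IsPathℕ path
  open WeakStability h ξ₀ t ξ

  d : ℕ
  d = suc d′

  σ : ℕ → Config
  σ = dyn h (dyn h ξ₀ t)

  first-up : Child (w 1) (w 0)
  first-up = first-step-up path (s≤s z≤n) (λ below → disjoint (w d) (inT ≤-refl) (below , ε))

  last-up : Child (w d′) (w d)
  last-up = last-step-up path (λ below → disjoint (w 0) (inT z≤n) (ε , below))

  Interior : ℕ → Set
  Interior s = ∀ {j} → suc j < d → parity (suc j + s) ≡ 0ℙ → σ s (w (suc j)) ≡ ξ

  Invariant : ℕ → Set
  Invariant s = Dominates h ξ (dyn h ξ₀ t) (comparison first) (w 0) s
              × Dominates h ξ (dyn h ξ₀ t) (comparison last) (w d) s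
              × Interior s

  on-path : ∀ {s} → Invariant s → ∀ {i} → i ≤ d → parity (i + s) ≡ 0ℙ → σ s (w i) ≡ ξ
  on-path (dom₀ , _ , _) {zero} _ even = dominated-end first (inT z≤n) (ξ-at-even z≤n refl) dom₀ even
  on-path (_ , dom_d , interior) {suc j} i≤d even with m≤n⇒m<n∨m≡n i≤d
  ... | inj₁ i<d  = interior i<d even
  ... | inj₂ refl = dominated-end last (inT ≤-refl) (ξ-at-even ≤-refl d-even) dom_d
                      (trans (sym (parity-+-evenˡ d _ d-even)) even)

  interior-step : ∀ {s} → Invariant s → Interior (suc s)
  interior-step {s} inv {j} j+1<d even =
    step-two-neighbours {h} {σ s} w_j≢w_j+2
      (Adj⇒∈nbrs (Adj-sym (adjacent (<⇒≤ j+1<d)))) (Adj⇒∈nbrs (adjacent j+1<d))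
      (on-path inv (<⇒≤ (<⇒≤ j+1<d)) neighbours-even) (on-path inv j+1<d neighbours-even)
    where
    neighbours-even : parity (j + s) ≡ 0ℙ
    neighbours-even = trans (sym (parity-suc-+-suc j s)) even
    w_j≢w_j+2 : w j ≢ w (suc (suc j))
    w_j≢w_j+2 eq = m≢1+n+m j (injective (<⇒≤ (<⇒≤ j+1<d)) j+1<d eq)

  invariant : ∀ s → Invariant s
  invariant zero =
      dominates-initially first
    , dominates-initially last
    , λ {j} j+1<d even → ξ-at-even (<⇒≤ j+1<d) (trans (cong parity (sym (+-identityʳ (suc j)))) even)
  invariant (suc s) =
      dominates-step first-up dom₀ (on-path inv (s≤s z≤n))
    , dominates-step last-up dom_d (λ odd → on-path inv (n≤1+n d′)
        (trans (sym (parity-suc-+-suc d′ s)) (trans (parity-+-evenˡ d (suc s) d-even) odd)))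
    , interior-step inv
    where
    inv : Invariant s
    inv = invariant s
    dom₀ : Dominates h ξ (dyn h ξ₀ t) (comparison first) (w 0) s
    dom₀ = proj₁ inv
    dom_d : Dominates h ξ (dyn h ξ₀ t) (comparison last) (w d) s
    dom_d = proj₁ (proj₂ inv)

  even-vertices-stable : ∀ {i} → i ≤ d → parity i ≡ 0ℙ → Stable h ξ₀ t (w i)
  even-vertices-stable {i} i≤d i-even = fixed-at-even-times⇒stable λ m m-even →
    on-path (invariant m) i≤d (trans (parity-+-evenˡ i m i-even) m-even)

claim11 : (h : ℕ) (ξ₀ : Config) (t : ℕ) (ξ : Spin) (d : ℕ)
    → 0 < d → d % 2 ≡ 0
    → (v : Fin (suc d) → Addr) → IsPath h d v
    → (∀ u → InT h u → ¬ (Desc (v zero) u × Desc (v (fromℕ d)) u))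
    → (∀ i → toℕ i % 2 ≡ 0 → dyn h ξ₀ t (v i) ≡ ξ)
    → WeaklyStable h ξ₀ t (v zero)
    → WeaklyStable h ξ₀ t (v (fromℕ d))
    → ∀ i → toℕ i % 2 ≡ 0 → Stable h ξ₀ t (v i)
claim11 h ξ₀ t ξ (suc d′) _ d%2≡0 v v-path disjoint ξ-at-even first last i i%2≡0 =
  subst (Stable h ξ₀ t) (cong v (clamp-toℕ i))
    (EvenVertices.even-vertices-stable (IsPath⇒IsPathℕ v-path) (≡-mod-2⇒parity≡ d 0 d%2≡0)
      w-disjoint w-ξ-at-even first (subst (WeaklyStable h ξ₀ t) v-last≡w-d last)
      (toℕ≤pred[n] i) (≡-mod-2⇒parity≡ (toℕ i) 0 i%2≡0))
  where
  d : ℕ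
  d = suc d′
  w : ℕ → Addr
  w = v ∘ clamp d
  v-last≡w-d : v (fromℕ d) ≡ w d
  v-last≡w-d = cong v (trans (sym (clamp-toℕ (fromℕ d))) (cong (clamp d) (toℕ-fromℕ d)))
  w-disjoint : ∀ u → InT h u → ¬ (Desc (w 0) u × Desc (w d) u)
  w-disjoint = subst (λ e → ∀ u → InT h u → ¬ (Desc (w 0) u × Desc e u)) v-last≡w-d disjoint
  w-ξ-at-even : ∀ {k} → k ≤ d → parity k ≡ 0ℙ → dyn h ξ₀ t (w k) ≡ ξ
  w-ξ-at-even {k} k≤d even = ξ-at-even (clamp d k)
    (parity≡0ℙ⇒%2≡0 (toℕ (clamp d k)) (trans (cong parity (toℕ-clamp k≤d)) even))
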